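{- Let $(S_n,\tau)$ be a temporal star with at most $k$ times at any edge and such that every two consecutive times at any edge differ by at least $\ell$ and by at most $u$. If $(S_n,\tau)$ is explorable, then $\mathrm{imw}(S_n,\tau)\le (2(k-1)u+1)/(\ell+1)$.
   Context: A temporal graph is a pair $(G,\tau)$ where $G$ is a finite simple graph and $\tau: E(G)\to 2^{\mathbb{N}}$ assigns to each edge $e$ a finite set $\tau(e)$ of times at which $e$ is active; $(e,t)$ with $t\in\tau(e)$ is a time-edge. A (strict) temporal $(x,y)$-walk is a sequence of time-edges $(e_1,t_1),\dots,(e_n,t_n)$ with $e_1,\dots,e_n$ a walk from $x$ to $y$ in $G$ and $t_1<\dots<t_n$; closed if $x=y$. Let $S_n$ be the star with $n$ leaves; a temporal star $(S_n,\tau)$ is explorable if it admits a closed temporal walk starting (and ending) at the center that visits every leaf. "Consecutive times" at an edge $e$ are elements $t<t'$ of $\tau(e)$ with no element of $\tau(e)$ strictly between them. The interval-membership-width is $\mathrm{imw}(G,\tau)=\max_t|\{e\in E(G):\min\tau(e)\le t\le\max\tau(e)\}|$. -}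

module Defs where

open import Data.Nat using (ℕ; zero; suc; _≤_; _<_; _∸_; _≤?_)
open import Data.Fin using (Fin)
open import Data.Maybe using (Maybe; nothing; just)
open import Data.List using (List; length; filter)
open import Data.List.Base using (allFin)
open import Data.List.Membership.Propositional using (_∈_)
open import Data.List.Relation.Unary.Any using (Any; any?)
open import Data.List.Relation.Unary.Unique.Propositional using (Unique)
open import Data.Product using (Σ; _×_; _,_)
open import Data.Product.Properties using ()
open import Relation.Nullary using (¬_; Dec)
open import Relation.Nullary.Decidable using (_×-dec_)
open import Relation.Binary.PropositionalEquality using (_≡_)
open import Data.Empty using (⊥)

-- A temporal star (S_n , τ): the star S_n has center `center` and leaves
-- `leaf i` (i : Fin n); its edges are indexed by Fin n, edge i = {center, leaf i}.
-- τ assigns to every edge a finite set of times, given as a duplicate-free list.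

Vertex : ℕ → Set
Vertex n = Maybe (Fin n)

center : ∀ {n} → Vertex n
center = nothing

leaf : ∀ {n} → Fin n → Vertex n
leaf = just

EdgeJoins : ∀ {n} → Vertex n → Vertex n → Fin n → Set
EdgeJoins nothing  (just j) i = i ≡ j
EdgeJoins (just j) nothing  i = i ≡ j
EdgeJoins nothing  nothing  i = ⊥
EdgeJoins (just _) (just _) i = ⊥

TimeAssignment : ℕ → Set
TimeAssignment n = Fin n → List ℕ

IsTimeSet : ∀ {n} → TimeAssignment n → Set
IsTimeSet τ = ∀ i → Unique (τ i)

-- Strict temporal walk from x to y, all of whose times are ≥ b.
-- Each step uses a time-edge (e , t) with t ∈ τ(e); times strictly increase.
data TWalk {n} (τ : TimeAssignment n) : ℕ → Vertex n → Vertex n → Set where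
  done : ∀ {b x} → TWalk τ b x x
  step : ∀ {b x z y} (e : Fin n) (t : ℕ) →
         b ≤ t → EdgeJoins x z e → t ∈ τ e →
         TWalk τ (suc t) z y → TWalk τ b x y

Visits : ∀ {n} {τ : TimeAssignment n} {b x y} → TWalk τ b x y → Vertex n → Set
Visits {x = x} done v = x ≡ v
Visits {x = x} (step e t _ _ _ w) v = (x ≡ v) Data.Sum.⊎ Visits w v
  where import Data.Sum

Explorable : ∀ {n} → TimeAssignment n → Set
Explorable {n} τ = Σ (TWalk τ 0 center center) λ w → ∀ (i : Fin n) → Visits w (leaf i)

Consecutive : ∀ {n} → TimeAssignment n → Fin n → ℕ → ℕ → Set
Consecutive τ e t t' =
  t ∈ τ e × t' ∈ τ e × t < t' × (∀ s → s ∈ τ e → ¬ (t < s × s < t'))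

-- min τ(e) ≤ t ≤ max τ(e)   (for a finite set: some time ≤ t and some time ≥ t)
InInterval : ∀ {n} → TimeAssignment n → Fin n → ℕ → Set
InInterval τ e t = Any (_≤ t) (τ e) × Any (t ≤_) (τ e)

inInterval? : ∀ {n} (τ : TimeAssignment n) e t → Dec (InInterval τ e t)
inInterval? τ e t = any? (_≤? t) (τ e) ×-dec any? (t ≤?_) (τ e)

intervalCount : ∀ {n} → TimeAssignment n → ℕ → ℕ
intervalCount {n} τ t = length (filter (λ e → inInterval? τ e t) (allFin n))

-- imw(S_n , τ) ≤ m   (imw is the maximum over t of intervalCount)
ImwAtMost : ∀ {n} → TimeAssignment n → ℕ → Set
ImwAtMost τ m = ∀ t → intervalCount τ t ≤ m

-- imw(S_n,τ) * q ≤ p , i.e. imw ≤ p / q for q > 0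
ImwTimesAtMost : ∀ {n} → TimeAssignment n → ℕ → ℕ → Set
ImwTimesAtMost τ q p = ∀ t → intervalCount τ t Data.Nat.* q ≤ p
  where import Data.Nat

-- Fix t and put D = (k ∸ 1) * u. With at most k times per edge and consecutive
-- times at most u apart, the times of an edge lie within D of each other, so every
-- edge whose interval contains t has all its times in [t ∸ D , t + D]. An exploring
-- walk visits the leaf of such an edge by a round trip at two times a < b of that
-- edge, hence b ≥ a + ℓ; these trips are disjoint, so each of them occupies at least
-- ℓ + 1 of the 2D + 1 time slots of the window.
module Submission where

open import Defs
open import Data.Nat using (ℕ; suc; _+_; _*_; _∸_; _≤_; _<_; _⊔_; _<?_; _≤?_; z≤n; s≤s; s≤s⁻¹)
open import Data.Nat.Properties
open import Data.Nat.Tactic.RingSolver using (solve-∀)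
open import Data.Fin as Fin using (Fin)
open import Data.List using (List; []; _∷_; length; filter; allFin)
open import Data.List.Properties using (filter-all; filter-notAll; filter-some)
open import Data.List.Extrema.Nat using (min; argmin-all; min≤⊤; min≤xs)
open import Data.List.Membership.Propositional using (_∈_; lose; find)
open import Data.List.Membership.Propositional.Properties using (∈-filter⁻; ∈-filter⁺)
import Data.List.Membership.DecPropositional as DecMembership
open import Data.List.Relation.Unary.Any using (Any; here)
open import Data.List.Relation.Unary.All as All using (All)
open import Data.List.Relation.Unary.AllPairs using (_∷_)
open import Data.List.Relation.Unary.Unique.Propositional using (Unique)
open import Data.List.Relation.Unary.Unique.Propositional.Properties using (filter⁺; allFin⁺)
open import Data.List.Relation.Binary.Sublist.Propositional using (_⊆_; ⊆-refl)
open import Data.List.Relation.Binary.Sublist.Heterogeneous.Properties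
  using (⊆-filter-Sublist; length-mono-≤; toPointwise)
open import Data.List.Relation.Binary.Pointwise using (Pointwise-≡⇒≡)
open import Data.Maybe using (just; nothing)
open import Data.Product using (∃-syntax; _×_; _,_; proj₁; proj₂)
open import Data.Sum as Sum using (_⊎_; inj₁; inj₂)
open import Function using (_∘_; id)
open import Level using (0ℓ)
open import Relation.Nullary using (¬_; Dec; yes; no; ¬?; contradiction)
open import Relation.Nullary.Decidable using (_×-dec_)
open import Relation.Unary using (Pred; Decidable)
open import Relation.Binary.Definitions using (DecidableEquality)
open import Relation.Binary.PropositionalEquality
  using (_≡_; _≢_; refl; sym; cong; subst; ≢-sym)

module _ {A : Set} {P Q : Pred A 0ℓ} (P? : Decidable P) (Q? : Decidable Q) where

  filter-length-< : ∀ {x xs} → (∀ {y} → Q y → P y) → x ∈ xs → P x → ¬ Q x →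
                    length (filter Q? xs) < length (filter P? xs)
  filter-length-< {x} {xs} Q⇒P x∈xs px ¬qx = ≤∧≢⇒< (length-mono-≤ sub) lengths-differ
    where
      sub : filter Q? xs ⊆ filter P? xs
      sub = ⊆-filter-Sublist Q? P? (λ { refl → Q⇒P }) (⊆-refl {x = xs})

      lengths-differ : length (filter Q? xs) ≢ length (filter P? xs)
      lengths-differ eq = ¬qx (proj₂ (∈-filter⁻ Q? {xs = xs}
        (subst (x ∈_) (sym (Pointwise-≡⇒≡ (toPointwise eq sub))) (∈-filter⁺ P? x∈xs px))))

module _ {A : Set} (_≟_ : DecidableEquality A) where

  remove : A → List A → List A
  remove a = filter (λ x → ¬? (x ≟ a))

  length-≤-suc-remove : ∀ a {xs} → Unique xs → length xs ≤ suc (length (remove a xs))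
  length-≤-suc-remove a {[]}     _          = z≤n
  length-≤-suc-remove a {x ∷ xs} (x∉ ∷ uxs) with x ≟ a
  ... | yes refl = s≤s (≤-reflexive (sym (cong length (filter-all _ (All.map ≢-sym x∉)))))
  ... | no _     = s≤s (length-≤-suc-remove a uxs)

-- Adjacent X t t' says that t < t' are consecutive elements of X; for X = τ e
-- it is literally Consecutive τ e t t'.
Adjacent : List ℕ → ℕ → ℕ → Set
Adjacent X t t' = t ∈ X × t' ∈ X × t < t' × (∀ s → s ∈ X → ¬ (t < s × s < t'))

GapsAtLeast : ℕ → List ℕ → Set
GapsAtLeast ℓ X = ∀ {t t'} → Adjacent X t t' → ℓ + t ≤ t'

GapsAtMost : ℕ → List ℕ → Set
GapsAtMost u X = ∀ {t t'} → Adjacent X t t' → t' ≤ u + t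

AllBetween : ℕ → ℕ → List ℕ → Set
AllBetween L R = All (λ s → L ≤ s × s ≤ R)

module _ {X : List ℕ} where

  adjacent-above : ∀ {a b} → a ∈ X → b ∈ X → a < b → ∃[ c ] Adjacent X a c × c ≤ b
  adjacent-above {a} {b} a∈X b∈X a<b = c , (a∈X , c∈X , a<c , nothing-between) , min≤⊤ b above
    where
      above = filter (a <?_) X
      c = min b above

      c∈X×a<c : c ∈ X × a < c
      c∈X×a<c = argmin-all (λ x → x) {P = λ x → x ∈ X × a < x}
                  (b∈X , a<b) (All.tabulate (∈-filter⁻ (a <?_)))
      c∈X = proj₁ c∈X×a<c
      a<c = proj₂ c∈X×a<c

      nothing-between : ∀ s → s ∈ X → ¬ (a < s × s < c)
      nothing-between s s∈X (a<s , s<c) =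
        <⇒≱ s<c (All.lookup (min≤xs b above) (∈-filter⁺ (a <?_) s∈X a<s))

  gapsAtLeast-< : ∀ {ℓ a b} → GapsAtLeast ℓ X → a ∈ X → b ∈ X → a < b → ℓ + a ≤ b
  gapsAtLeast-< gaps a∈X b∈X a<b =
    let _ , adj , c≤b = adjacent-above a∈X b∈X a<b in ≤-trans (gaps adj) c≤b

  module _ {u} (gaps : GapsAtMost u X) where

    private
      InRange : ℕ → ℕ → ℕ → Set
      InRange s s' x = s < x × x ≤ s'

      inRange? : ∀ s s' → Decidable (InRange s s')
      inRange? s s' x = (s <? x) ×-dec (x ≤? s')

      countBetween : ℕ → ℕ → ℕ
      countBetween s s' = length (filter (inRange? s s') X)

    -- Step from s to its successor in X: it is at most u further and lies in (s , s'].
    ≤+countBetween*u : ∀ m {s s'} → s ∈ X → s' ∈ X → countBetween s s' ≤ m → s' ≤ s + m * u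
    ≤+countBetween*u m {s} {s'} s∈X s'∈X count≤m with s <? s'
    ... | no s≮s' = ≤-trans (≮⇒≥ s≮s') (m≤m+n s (m * u))
    ... | yes s<s' with m | adjacent-above s∈X s'∈X s<s'
    ...   | 0     | _ = contradiction
      (≤-trans (filter-some (inRange? s s') (lose s'∈X (s<s' , ≤-refl))) count≤m) n≮0
    ...   | suc m | c , adj@(_ , c∈X , s<c , _) , c≤s' = begin
      s'               ≤⟨ ≤+countBetween*u m c∈X s'∈X (s≤s⁻¹ (≤-trans fewer count≤m)) ⟩
      c + m * u        ≤⟨ +-monoˡ-≤ (m * u) (gaps adj) ⟩
      u + s + m * u    ≡⟨ regroup u s m ⟩
      s + suc m * u    ∎
      where
        open ≤-Reasoning
        regroup : ∀ u s m → u + s + m * u ≡ s + suc m * u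
        regroup = solve-∀
        fewer : countBetween c s' < countBetween s s'
        fewer = filter-length-< (inRange? s s') (inRange? c s')
                  (λ (c<x , x≤s') → <-trans s<c c<x , x≤s') c∈X (s<c , c≤s') (<-irrefl refl ∘ proj₁)

    gapsAtMost-spread : ∀ {s s'} → s ∈ X → s' ∈ X → s' ≤ s + (length X ∸ 1) * u
    gapsAtMost-spread {s} {s'} s∈X s'∈X = ≤+countBetween*u (length X ∸ 1) s∈X s'∈X
      (subst (countBetween s s' ≤_) (pred[m∸n]≡m∸[1+n] (length X) 0)
        (<⇒≤pred (filter-notAll (inRange? s s') X (lose s∈X (<-irrefl refl ∘ proj₁)))))

window-of-interval : ∀ {X D t} → (∀ {s s'} → s ∈ X → s' ∈ X → s' ≤ s + D) →
                     Any (_≤ t) X → Any (t ≤_) X → AllBetween (t ∸ D) (t + D) X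
window-of-interval {D = D} {t} spread below above with find below | find above
... | p , p∈X , p≤t | q , q∈X , t≤q = All.tabulate λ {s} s∈X →
  m≤n+o⇒m∸n≤o t D (≤-trans t≤q (≤-trans (spread s∈X q∈X) (≤-reflexive (+-comm s D)))) ,
  ≤-trans (spread p∈X s∈X) (+-monoˡ-≤ D p≤t)

trip-then-rest : ∀ {m m' ℓ x a b y} → m ≤ suc m' → x ≤ a → ℓ + a ≤ b →
                 m' * (ℓ + 1) + suc b ≤ y → m * (ℓ + 1) + x ≤ y
trip-then-rest {m} {m'} {ℓ} {x} {a} {b} {y} m≤1+m' x≤a ℓ+a≤b rest = begin
  m * (ℓ + 1) + x             ≤⟨ +-mono-≤ (*-monoˡ-≤ (ℓ + 1) m≤1+m') x≤a ⟩
  suc m' * (ℓ + 1) + a        ≡⟨ regroup m' ℓ a ⟩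
  m' * (ℓ + 1) + suc (ℓ + a)  ≤⟨ +-monoʳ-≤ (m' * (ℓ + 1)) (s≤s ℓ+a≤b) ⟩
  m' * (ℓ + 1) + suc b        ≤⟨ rest ⟩
  y                           ∎
  where
    open ≤-Reasoning
    regroup : ∀ m' ℓ a → suc m' * (ℓ + 1) + a ≡ m' * (ℓ + 1) + suc (ℓ + a)
    regroup = solve-∀

module _ {n} (τ : TimeAssignment n) {ℓ} (gaps : ∀ e → GapsAtLeast ℓ (τ e)) {L R : ℕ} where

  open DecMembership (Fin._≟_ {n}) using (_∈?_)

  -- A closed walk from the center consists of round trips center → leaf j → center
  -- at times a < b of edge j. Induction on the walk, dropping j from E after its
  -- first trip; lo ⊔ L bounds from below the times still available for E.
  visits-fit-window : ∀ {lo} (w : TWalk τ lo center center) (E : List (Fin n)) → Unique E →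
    (∀ {e} → e ∈ E → AllBetween L R (τ e)) → (∀ {e} → e ∈ E → Visits w (leaf e)) →
    E ≡ [] ⊎ length E * (ℓ + 1) + (lo ⊔ L) ≤ suc R
  visits-fit-window done [] _ _ _ = inj₁ refl
  visits-fit-window done (_ ∷ _) _ _ visited with visited (here refl)
  ... | ()
  visits-fit-window (step {z = nothing} _ _ _ () _ _) _ _ _ _
  visits-fit-window (step {z = just _} _ _ _ refl _ (step {z = just _} _ _ _ () _ _)) _ _ _ _
  visits-fit-window {lo}
    w@(step {z = just j} _ a lo≤a refl a∈τj (step {z = nothing} _ b a<b refl b∈τj w'))
    E uE window visited = after-trip (j ∈? E)
    where
      round-trip : ∀ {e} → Visits w (leaf e) → j ≡ e ⊎ Visits w' (leaf e)
      round-trip (inj₁ ())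
      round-trip (inj₂ (inj₁ refl)) = inj₁ refl
      round-trip (inj₂ (inj₂ v)) = inj₂ v

      lo≤sucb : lo ≤ suc b
      lo≤sucb = ≤-trans lo≤a (≤-trans (n≤1+n a) (≤-trans a<b (n≤1+n b)))

      E' = remove Fin._≟_ j E

      visited' : ∀ {e} → e ∈ E' → Visits w' (leaf e)
      visited' e∈E' with ∈-filter⁻ (λ x → ¬? (x Fin.≟ j)) {xs = E} e∈E'
      ... | e∈E , e≢j = Sum.[ (λ { refl → contradiction refl e≢j }) , id ] (round-trip (visited e∈E))

      after-trip : Dec (j ∈ E) → E ≡ [] ⊎ length E * (ℓ + 1) + (lo ⊔ L) ≤ suc R
      after-trip (no j∉E) = Sum.map₂ (≤-trans (+-monoʳ-≤ _ (⊔-monoˡ-≤ L lo≤sucb)))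
        (visits-fit-window w' E uE window λ e∈E →
          Sum.[ (λ { refl → contradiction e∈E j∉E }) , id ] (round-trip (visited e∈E)))
      after-trip (yes j∈E) = inj₂ (trip-then-rest (length-≤-suc-remove Fin._≟_ j uE)
        (⊔-lub lo≤a (proj₁ (All.lookup (window j∈E) a∈τj)))
        (gapsAtLeast-< (gaps j) a∈τj b∈τj a<b)
        (rest-fits (visits-fit-window w' E' (filter⁺ _ uE)
          (window ∘ proj₁ ∘ ∈-filter⁻ (λ x → ¬? (x Fin.≟ j)) {xs = E}) visited')))
        where
          rest-fits : E' ≡ [] ⊎ length E' * (ℓ + 1) + (suc b ⊔ L) ≤ suc R →
                      length E' * (ℓ + 1) + suc b ≤ suc R
          rest-fits (inj₁ E'≡[]) rewrite E'≡[] = s≤s (proj₂ (All.lookup (window j∈E) b∈τj))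
          rest-fits (inj₂ fits) = ≤-trans (+-monoʳ-≤ _ (m≤m⊔n (suc b) L)) fits

window-length : ∀ x t D → x + (t ∸ D) ≤ suc (t + D) → x ≤ 2 * D + 1
window-length x t D fits = +-cancelʳ-≤ t x (2 * D + 1) (begin
  x + t               ≤⟨ +-monoʳ-≤ x (m≤n+m∸n t D) ⟩
  x + (D + (t ∸ D))   ≡⟨ x+[D+y]≡D+[x+y] x D (t ∸ D) ⟩
  D + (x + (t ∸ D))   ≤⟨ +-monoʳ-≤ D fits ⟩
  D + suc (t + D)     ≡⟨ D+[1+t+D]≡2D+1+t D t ⟩
  2 * D + 1 + t       ∎)
  where
    open ≤-Reasoning
    x+[D+y]≡D+[x+y] : ∀ x D y → x + (D + y) ≡ D + (x + y)
    x+[D+y]≡D+[x+y] = solve-∀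
    D+[1+t+D]≡2D+1+t : ∀ D t → D + suc (t + D) ≡ 2 * D + 1 + t
    D+[1+t+D]≡2D+1+t = solve-∀

lemma5p1 : (n k ℓ u : ℕ) (τ : TimeAssignment n) →
    IsTimeSet τ →
    (∀ (e : Fin n) → length (τ e) ≤ k) →
    (∀ (e : Fin n) (t t' : ℕ) → Consecutive τ e t t' → ℓ + t ≤ t' × t' ≤ u + t) →
    Explorable τ →
    ImwTimesAtMost τ (ℓ + 1) (2 * (k ∸ 1) * u + 1)
lemma5p1 n k ℓ u τ _ length≤k consecutive (w , visits) t =
  ≤-trans (bound (visits-fit-window τ (λ e → proj₁ ∘ consecutive e _ _)
                    w E (filter⁺ _ (allFin⁺ n)) window (λ _ → visits _)))
          (≤-reflexive (cong (_+ 1) (sym (*-assoc 2 (k ∸ 1) u))))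
  where
    D = (k ∸ 1) * u
    E = filter (λ e → inInterval? τ e t) (allFin n)

    spread : ∀ e {s s'} → s ∈ τ e → s' ∈ τ e → s' ≤ s + D
    spread e {s} s∈τe s'∈τe = ≤-trans (gapsAtMost-spread (proj₂ ∘ consecutive e _ _) s∈τe s'∈τe)
      (+-monoʳ-≤ s (*-monoˡ-≤ u (∸-monoˡ-≤ 1 (length≤k e))))

    window : ∀ {e} → e ∈ E → AllBetween (t ∸ D) (t + D) (τ e)
    window {e} e∈E =
      let below , above = proj₂ (∈-filter⁻ (λ e → inInterval? τ e t) {xs = allFin n} e∈E)
      in window-of-interval (spread e) below above

    bound : E ≡ [] ⊎ length E * (ℓ + 1) + (0 ⊔ (t ∸ D)) ≤ suc (t + D) →
            length E * (ℓ + 1) ≤ 2 * D + 1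
    bound (inj₁ E≡[]) rewrite E≡[] = z≤n
    bound (inj₂ fits) = window-length _ t D fits
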